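{- If $8\leq n\leq 11$, then $\delta(B_n)\geq 2n-11$ and $\delta(C_n)\geq 2n-11$.
   Context: Polygons are treated combinatorially: a convex polygon is a finite set of vertices with a clockwise cyclic order; edges are $2$-element vertex sets, two edges cross if disjoint with alternating vertices in the cyclic order; a triangulation is an inclusion-maximal set of pairwise non-crossing edges; for an interior edge $\varepsilon$ of $T$, $T/\varepsilon$ is obtained by replacing $\varepsilon$ by the other diagonal of the unique quadrilateral with diagonal $\varepsilon$ and sides in $T$ (a flip). For a pair $P=\{U,V\}$, $\delta(P)$ is the minimum number of flips transforming $U$ into $V$. Deletion: for a vertex $a$ of a polygon with at least $4$ vertices, with clockwise successor $b$, $T\ominus a=\{\varepsilon \text{ with } a \text{ replaced by } b:\varepsilon\in T\setminus\{\{a,b\}\}\}$. Zigzag: for $N\geq 4$, on the polygon with vertices $0,\dots,N-1$ labeled clockwise (mod $N$), $Z_N$ is the triangulation whose interior edges are $\varepsilon_{2k+1}=\{2-k,4+k\}$ and $\varepsilon_{2k+2}=\{1-k,4+k\}$ ($k\geq0$), for indices $1,\dots,N-3$. In a polygon with $N$ vertices, $\bar k=k+\lfloor N/2\rfloor$. Pair $A_n$ ($n\geq3$): $A_n^-$ is $Z_{n+4}$ with $0,1,\bar0,\bar1$ deleted successively ($\bar k=k+\lfloor (n+4)/2\rfloor$), remaining vertices relabeled clockwise $0,\dots,n-1$ with vertex $2$ keeping label $2$; $A_n^+$ is $Z_{n+4}$ with $4,5,\bar4,\bar5$ deleted successively, relabeled clockwise $0,\dots,n-1$ with former vertex $2$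 getting label $1$. Both are triangulations of the polygon with vertices $0,\dots,n-1$. Pairs $B_n$, $C_n$ ($n\geq 7$): let $T=A_{n+1}^-/\{2,5\}/\{2,4\}/\{2,6\}$ (flipped in this order; the last flip introduces $\{1,3\}$, also an edge of $A_{n+1}^+$). With $E=\{\{1,2\},\{2,3\}\}$, $B_n^-=T\setminus E$ and $B_n^+=A_{n+1}^+\setminus E$ are triangulations of the polygon with vertex $2$ removed, whose vertices are relabeled clockwise $0,\dots,n-1$ so that vertex $3$ keeps its label (old $n\mapsto0$, $0\mapsto1$, $1\mapsto2$, $k\mapsto k$ for $3\leq k\leq n-1$). $C_n^-=B_n^-/\{4,6\}$; $B_n=\{B_n^-,B_n^+\}$ and $C_n=\{C_n^-,B_n^+\}$. -}

module Defs where

open import Data.Nat using (ℕ; zero; suc; _+_; _*_; _∸_; _≤_; _≡ᵇ_)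
open import Data.Nat.DivMod using (_/_; _%_)
open import Data.Bool using (Bool; true; false; _∧_; _∨_; not; if_then_else_)
open import Data.List using (List; []; _∷_; map; filter; upTo; length; _++_)
open import Data.Bool.ListAction using (any)
open import Data.Product using (_×_; _,_; proj₁; proj₂; Σ)
open import Data.Sum using (_⊎_)
open import Data.Empty using (⊥)
open import Relation.Binary.PropositionalEquality using (_≡_)
open import Relation.Nullary.Decidable using (T?)
open import Function.Bundles using (_⇔_)

-- A polygon is given by its list of vertices (natural numbers) in
-- clockwise cyclic order.  The standard polygon with N vertices is
-- upTo N = 0 , 1 , … , N-1 (clockwise).
-- An edge is a 2-element vertex set, represented by an (unordered) pair:
-- (a , b) and (b , a) denote the same edge (see sameEdge).
-- A set of edges is represented by a list; only membership matters
-- (duplicates and order are irrelevant).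

Edge : Set
Edge = ℕ × ℕ

sameEdge : Edge → Edge → Bool
sameEdge (a , b) (c , d) = ((a ≡ᵇ c) ∧ (b ≡ᵇ d)) ∨ ((a ≡ᵇ d) ∧ (b ≡ᵇ c))

_∈ᴱ_ : Edge → List Edge → Bool
e ∈ᴱ T = any (sameEdge e) T

_≈ᴱ_ : List Edge → List Edge → Set
U ≈ᴱ V = (e : Edge) → (e ∈ᴱ U ≡ true) ⇔ (e ∈ᴱ V ≡ true)

_≠ᵇ_ : ℕ → ℕ → Bool
x ≠ᵇ y = not (x ≡ᵇ y)

-- For an interior edge ε = {a,c} of a triangulation T of the
-- polygon with vertex list vs, the vertices x with {a,x},{x,c} ∈ T are
-- exactly the two remaining vertices b, d of the unique quadrilateral
-- with diagonal ε and sides in T.  T/ε replaces ε by {b,d}.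

quadApexes : List ℕ → List Edge → Edge → List ℕ
quadApexes vs T (a , c) =
  filter (λ x → T? (((x ≠ᵇ a) ∧ (x ≠ᵇ c)) ∧ (((a , x) ∈ᴱ T) ∧ ((x , c) ∈ᴱ T)))) vs

-- (the final clause is never used for an interior edge of a triangulation)
flipAt : List ℕ → List Edge → Edge → List Edge
flipAt vs T ε with quadApexes vs T ε
... | b ∷ d ∷ _ = (b , d) ∷ filter (λ f → T? (not (sameEdge f ε))) T
... | _         = T

isSide : ℕ → Edge → Bool
isSide n (a , b) = (((a + 1) % suc (n ∸ 1)) ≡ᵇ b) ∨ (((b + 1) % suc (n ∸ 1)) ≡ᵇ a)

FlipStep : ℕ → List Edge → List Edge → Set
FlipStep n U V =
  Σ Edge λ ε → (ε ∈ᴱ U ≡ true) × (isSide n ε ≡ false) × (V ≈ᴱ flipAt (upTo n) U ε)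

FlipPath : ℕ → ℕ → List Edge → List Edge → Set
FlipPath n zero    U V = U ≈ᴱ V
FlipPath n (suc k) U V = Σ (List Edge) λ W → FlipStep n U W × FlipPath n k W V

δ≥ : ℕ → List Edge × List Edge → ℕ → Set
δ≥ n (U , V) m = (k : ℕ) → FlipPath n k U V → m ≤ k

-- Zigzag triangulation Z_N on the polygon 0,…,N-1 (labels mod N).
-- It contains the N sides and the interior edges ε_1,…,ε_{N-3}:
--   ε_{2k+1} = {2-k, 4+k},  ε_{2k+2} = {1-k, 4+k}.

isOdd : ℕ → Bool
isOdd zero = false
isOdd (suc m) = not (isOdd m)

zigzagEdge : ℕ → ℕ → Edge
zigzagEdge N i =
  if isOdd i
  then (((N + 2) ∸ ((i ∸ 1) / 2)) % suc (N ∸ 1) , (4 + ((i ∸ 1) / 2)) % suc (N ∸ 1))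
  else (((N + 1) ∸ ((i ∸ 2) / 2)) % suc (N ∸ 1) , (4 + ((i ∸ 2) / 2)) % suc (N ∸ 1))

Z : ℕ → List Edge
Z N = map (λ i → (i , (i + 1) % suc (N ∸ 1))) (upTo N)
   ++ map (λ j → zigzagEdge N (suc j)) (upTo (N ∸ 3))

Poly : Set
Poly = List ℕ × List Edge

succIn : List ℕ → ℕ → ℕ
succIn vs a = go vs
  where
  headOr : List ℕ → ℕ
  headOr []      = a
  headOr (x ∷ _) = x
  first : ℕ
  first = headOr vs
  go : List ℕ → ℕ
  go []           = a
  go (x ∷ [])     = if x ≡ᵇ a then first else a
  go (x ∷ y ∷ xs) = if x ≡ᵇ a then y else go (y ∷ xs)

replaceV : ℕ → ℕ → ℕ → ℕ
replaceV a b x = if x ≡ᵇ a then b else x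

_⊖_ : Poly → ℕ → Poly
(vs , T) ⊖ a =
  filter (λ x → T? ((x ≠ᵇ a))) vs ,
  map (λ { (x , y) → (replaceV a b x , replaceV a b y) })
      (filter (λ f → T? (not (sameEdge f (a , b)))) T)
  where b = succIn vs a

indexOf : List ℕ → ℕ → ℕ
indexOf []       x = 0
indexOf (y ∷ ys) x = if y ≡ᵇ x then 0 else suc (indexOf ys x)

-- relabel the vertices clockwise 0,…,m-1 (m = number of vertices) so
-- that vertex v0 gets label L
relabel : ℕ → ℕ → Poly → List Edge
relabel v0 L (vs , T) =
  map (λ { (x , y) → (lab x , lab y) }) T
  where
  m = length vs
  lab : ℕ → ℕ
  lab x = ((indexOf vs x + L + m) ∸ indexOf vs v0) % suc (m ∸ 1)

A⁻ : ℕ → List Edge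
A⁻ n = relabel 2 2 (((((upTo N , Z N) ⊖ 0) ⊖ 1) ⊖ bar 0) ⊖ bar 1)
  where
  N = n + 4
  bar : ℕ → ℕ
  bar k = (k + N / 2) % suc (N ∸ 1)

A⁺ : ℕ → List Edge
A⁺ n = relabel 2 1 (((((upTo N , Z N) ⊖ 4) ⊖ 5) ⊖ bar 4) ⊖ bar 5)
  where
  N = n + 4
  bar : ℕ → ℕ
  bar k = (k + N / 2) % suc (N ∸ 1)

Tᴮ : ℕ → List Edge
Tᴮ n = flipAt vs (flipAt vs (flipAt vs (A⁻ (suc n)) (2 , 5)) (2 , 4)) (2 , 6)
  where vs = upTo (suc n)

removeE-relabel : ℕ → List Edge → List Edge
removeE-relabel n T =
  map (λ { (x , y) → (lab x , lab y) })
      (filter (λ f → T? (not ((f ∈ᴱ ((1 , 2) ∷ (2 , 3) ∷ []))))) T)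
  where
  lab : ℕ → ℕ
  lab x = if x ≡ᵇ n then 0 else if x ≡ᵇ 0 then 1 else if x ≡ᵇ 1 then 2 else x

B⁻ : ℕ → List Edge
B⁻ n = removeE-relabel n (Tᴮ n)

B⁺ : ℕ → List Edge
B⁺ n = removeE-relabel n (A⁺ (suc n))

C⁻ : ℕ → List Edge
C⁻ n = flipAt (upTo n) (B⁻ n) (4 , 6)

B : ℕ → List Edge × List Edge
B n = B⁻ n , B⁺ n

C : ℕ → List Edge × List Edge
C n = C⁻ n , B⁺ n

-- A flip removes exactly one edge, so transforming U into V takes at least
-- as many flips as U has edges outside V.  For n = 8 this count already
-- reaches 2n − 11.  For 9 ≤ n ≤ 11 the bound is sharpened by a finite
-- search: a target c ≥ 1 is certified at W when W has c edges outside V, or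
-- when W ≠ V and every flip of W certifies c − 1; the search is carried out
-- by evaluation.
module Submission where

open import Defs
open import Data.Bool using (Bool; true; false; _∧_; _∨_; not; if_then_else_)
open import Data.Bool.ListAction using (or; any; all)
open import Data.Bool.Properties
  using (∧-comm; ∨-comm; ∧-zeroʳ; ∨-zeroʳ; ∧-conicalˡ; ∧-conicalʳ; ∨-conicalˡ; ∨-conicalʳ; ⇔→≡; T-≡)
open import Data.Empty using (⊥-elim)
open import Data.List using (List; []; _∷_; map; filter; upTo; concatMap)
open import Data.List.Properties using (map-cong)
open import Data.Nat using (ℕ; zero; suc; _+_; _*_; _∸_; _≤_; _≤ᵇ_; _≡ᵇ_; z≤n; s≤s)
open import Data.Nat.DivMod using (_%_)
open import Data.Nat.Properties
  using (≡ᵇ⇒≡; ≤ᵇ⇒≤; ≤-refl; ≤-trans; ≤-reflexive; n≤1+n; 1+n≰n; m≤m+n;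
         +-comm; +-suc; +-mono-≤; +-monoˡ-≤; +-monoʳ-≤; m≤n⇒∃[o]m+o≡n)
open import Data.Product using (Σ; _×_; _,_; proj₁; proj₂; swap)
open import Data.Sum using (_⊎_; inj₁; inj₂; [_,_])
open import Function.Bundles using (Equivalence)
open import Relation.Binary.PropositionalEquality using (_≡_; refl; sym; trans; cong; cong₂; subst)
open import Relation.Nullary.Decidable using (T?)

∧-≡true : ∀ {x y} → x ∧ y ≡ true → x ≡ true × y ≡ true
∧-≡true {x} {y} h = ∧-conicalˡ x y h , ∧-conicalʳ x y h

∨-≡true : ∀ {x y} → x ∨ y ≡ true → x ≡ true ⊎ y ≡ true
∨-≡true {true}  _ = inj₁ refl
∨-≡true {false} h = inj₂ h

∨-≡false : ∀ {x y} → x ∨ y ≡ false → x ≡ false × y ≡ false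
∨-≡false {x} {y} h = ∨-conicalˡ x y h , ∨-conicalʳ x y h

≡ᵇ-≡true⇒≡ : ∀ {m n} → (m ≡ᵇ n) ≡ true → m ≡ n
≡ᵇ-≡true⇒≡ {m} {n} h = ≡ᵇ⇒≡ m n (Equivalence.from T-≡ h)

≤ᵇ-≡true⇒≤ : ∀ {m n} → (m ≤ᵇ n) ≡ true → m ≤ n
≤ᵇ-≡true⇒≤ {m} {n} h = ≤ᵇ⇒≤ m n (Equivalence.from T-≡ h)

filterᵇ-cong : {A : Set} {p q : A → Bool} → (∀ x → p x ≡ q x) → ∀ xs →
  filter (λ x → T? (p x)) xs ≡ filter (λ x → T? (q x)) xs
filterᵇ-cong p≗q [] = refl
filterᵇ-cong {p = p} {q} p≗q (x ∷ xs) with p x | q x | p≗q x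
... | true  | .true  | refl = cong (x ∷_) (filterᵇ-cong p≗q xs)
... | false | .false | refl = filterᵇ-cong p≗q xs

any-filter : {A : Set} (s p : A → Bool) {c : Bool} → (∀ x → s x ≡ true → p x ≡ c) →
  ∀ xs → any s (filter (λ x → T? (p x)) xs) ≡ any s xs ∧ c
any-filter s p h [] = refl
any-filter s p h (x ∷ xs) with p x in px
... | true with s x in sx
...   | true  = trans (sym px) (h x sx)
...   | false = any-filter s p h xs
any-filter s p h (x ∷ xs) | false with s x in sx
...   | true rewrite any-filter s p h xs | trans (sym (h x sx)) px = ∧-zeroʳ _
...   | false = any-filter s p h xs

sameEdge-sound : ∀ e f → sameEdge e f ≡ true → e ≡ f ⊎ e ≡ swap f
sameEdge-sound (a , b) (c , d) h with ∨-≡true {(a ≡ᵇ c) ∧ (b ≡ᵇ d)} h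
... | inj₁ h₁ = let ac , bd = ∧-≡true h₁ in inj₁ (cong₂ _,_ (≡ᵇ-≡true⇒≡ ac) (≡ᵇ-≡true⇒≡ bd))
... | inj₂ h₂ = let ad , bc = ∧-≡true h₂ in inj₂ (cong₂ _,_ (≡ᵇ-≡true⇒≡ ad) (≡ᵇ-≡true⇒≡ bc))

sameEdge-swapˡ : ∀ e f → sameEdge (swap e) f ≡ sameEdge e f
sameEdge-swapˡ (a , b) (c , d)
  rewrite ∧-comm (b ≡ᵇ c) (a ≡ᵇ d) | ∧-comm (b ≡ᵇ d) (a ≡ᵇ c) =
  ∨-comm ((a ≡ᵇ d) ∧ (b ≡ᵇ c)) ((a ≡ᵇ c) ∧ (b ≡ᵇ d))

sameEdge-swapʳ : ∀ e f → sameEdge e (swap f) ≡ sameEdge e f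
sameEdge-swapʳ (a , b) (c , d) = ∨-comm ((a ≡ᵇ d) ∧ (b ≡ᵇ c)) ((a ≡ᵇ c) ∧ (b ≡ᵇ d))

sameEdge-congˡ : ∀ e f → sameEdge e f ≡ true → ∀ g → sameEdge e g ≡ sameEdge f g
sameEdge-congˡ e f h g with sameEdge-sound e f h
... | inj₁ refl = refl
... | inj₂ refl = sameEdge-swapˡ f g

sameEdge-congʳ : ∀ e f → sameEdge e f ≡ true → ∀ g → sameEdge g e ≡ sameEdge g f
sameEdge-congʳ e f h g with sameEdge-sound e f h
... | inj₁ refl = refl
... | inj₂ refl = sameEdge-swapʳ g f

isSide-cong : ∀ n e f → sameEdge e f ≡ true → isSide n e ≡ isSide n f
isSide-cong n e (a , b) h with sameEdge-sound e (a , b) h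
... | inj₁ refl = refl
... | inj₂ refl = ∨-comm (((b + 1) % suc (n ∸ 1)) ≡ᵇ a) (((a + 1) % suc (n ∸ 1)) ≡ᵇ b)

∈ᴱ-swap : ∀ e W → swap e ∈ᴱ W ≡ e ∈ᴱ W
∈ᴱ-swap e W = cong or (map-cong (sameEdge-swapˡ e) W)

∈ᴱ-filter : ∀ e ε W →
  e ∈ᴱ filter (λ f → T? (not (sameEdge f ε))) W ≡ e ∈ᴱ W ∧ not (sameEdge e ε)
∈ᴱ-filter e ε = any-filter (sameEdge e) (λ f → not (sameEdge f ε))
  (λ f ef → cong not (sym (sameEdge-congˡ e f ef ε)))

all-∈ᴱ : ∀ (p : Edge → Bool) ε L → all p L ≡ true → ε ∈ᴱ L ≡ true →
  Σ Edge λ l → sameEdge ε l ≡ true × p l ≡ true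
all-∈ᴱ p ε (l ∷ L) h ε∈ with ∧-≡true h | ∨-≡true {sameEdge ε l} ε∈
... | pl , _    | inj₁ εl = l , εl , pl
... | _  , allL | inj₂ ε∈L = all-∈ᴱ p ε L allL ε∈L

_≐_ : List Edge → List Edge → Set
U ≐ V = ∀ e → e ∈ᴱ U ≡ e ∈ᴱ V

≈ᴱ⇒≐ : ∀ {U V} → U ≈ᴱ V → U ≐ V
≈ᴱ⇒≐ U≈V e = ⇔→≡ (U≈V e)

quadApexes-cong : ∀ vs {W W' ε ε'} → W ≐ W' → sameEdge ε ε' ≡ true →
  quadApexes vs W ε ≡ quadApexes vs W' ε'
quadApexes-cong vs {W} {W'} {a , c} {a' , c'} W≐W' εε'
  with sameEdge-sound (a , c) (a' , c') εε'
... | inj₁ refl = filterᵇ-cong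
  (λ x → cong₂ (λ u v → ((x ≠ᵇ a) ∧ (x ≠ᵇ c)) ∧ (u ∧ v)) (W≐W' (a , x)) (W≐W' (x , c))) vs
... | inj₂ refl = filterᵇ-cong
  (λ x → cong₂ _∧_ (∧-comm (x ≠ᵇ a) (x ≠ᵇ c))
    (trans (∧-comm ((a , x) ∈ᴱ W) ((x , c) ∈ᴱ W))
      (cong₂ _∧_ (trans (∈ᴱ-swap (c , x) W) (W≐W' (c , x)))
                 (trans (∈ᴱ-swap (x , a) W) (W≐W' (x , a)))))) vs

flipAt-cong : ∀ vs {W W' ε ε'} → W ≐ W' → sameEdge ε ε' ≡ true →
  flipAt vs W ε ≐ flipAt vs W' ε'
flipAt-cong vs {W} {W'} {ε} {ε'} W≐W' εε' e
  with quadApexes vs W ε | quadApexes vs W' ε' | quadApexes-cong vs {W} {W'} {ε} {ε'} W≐W' εε'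
... | b ∷ d ∷ _ | ._ | refl = cong (sameEdge e (b , d) ∨_)
  (trans (∈ᴱ-filter e ε W)
    (trans (cong₂ (λ u s → u ∧ not s) (W≐W' e) (sameEdge-congʳ ε ε' εε' e))
      (sym (∈ᴱ-filter e ε' W'))))
... | []        | ._ | refl = W≐W' e
... | _ ∷ []    | ._ | refl = W≐W' e

flipAt-keeps : ∀ vs W ε e → e ∈ᴱ W ≡ true →
  e ∈ᴱ flipAt vs W ε ≡ true ⊎ sameEdge e ε ≡ true
flipAt-keeps vs W ε e e∈W with quadApexes vs W ε
... | [] = inj₁ e∈W
... | _ ∷ [] = inj₁ e∈W
... | b ∷ d ∷ _ with sameEdge e ε in eε
...   | true = inj₂ refl
...   | false = inj₁ (trans (cong (sameEdge e (b , d) ∨_)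
                         (trans (∈ᴱ-filter e ε W) (cong₂ (λ u s → u ∧ not s) e∈W eε)))
                       (∨-zeroʳ _))

countᵇ : {A : Set} → (A → Bool) → List A → ℕ
countᵇ p []       = 0
countᵇ p (x ∷ xs) = if p x then suc (countᵇ p xs) else countᵇ p xs

countᵇ-cong : {A : Set} {p q : A → Bool} → (∀ x → p x ≡ q x) →
  ∀ xs → countᵇ p xs ≡ countᵇ q xs
countᵇ-cong p≗q [] = refl
countᵇ-cong p≗q (x ∷ xs) rewrite p≗q x | countᵇ-cong p≗q xs = refl

countᵇ-∷ : {A : Set} (p : A → Bool) (x : A) (xs : List A) → countᵇ p xs ≤ countᵇ p (x ∷ xs)
countᵇ-∷ p x xs with p x
... | true  = n≤1+n _
... | false = ≤-refl

countᵇ-subadditive : {A : Set} {p q r : A → Bool} →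
  (∀ x → p x ≡ true → q x ≡ true ⊎ r x ≡ true) →
  ∀ xs → countᵇ p xs ≤ countᵇ q xs + countᵇ r xs
countᵇ-subadditive h [] = z≤n
countᵇ-subadditive {p = p} {q} {r} h (x ∷ xs) with p x in px
... | false = ≤-trans (countᵇ-subadditive h xs) (+-mono-≤ (countᵇ-∷ q x xs) (countᵇ-∷ r x xs))
... | true with h x px
...   | inj₁ qx rewrite qx =
  s≤s (≤-trans (countᵇ-subadditive h xs) (+-monoʳ-≤ (countᵇ q xs) (countᵇ-∷ r x xs)))
...   | inj₂ rx rewrite rx =
  ≤-trans (s≤s (≤-trans (countᵇ-subadditive h xs) (+-monoˡ-≤ (countᵇ r xs) (countᵇ-∷ q x xs))))
          (≤-reflexive (sym (+-suc _ _)))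

countᵇ-filter-not : {A : Set} (p : A → Bool) (xs : List A) →
  countᵇ p (filter (λ x → T? (not (p x))) xs) ≡ 0
countᵇ-filter-not p [] = refl
countᵇ-filter-not p (x ∷ xs) with p x in px
... | true  = countᵇ-filter-not p xs
... | false rewrite px = countᵇ-filter-not p xs

distinctEdges : List Edge → Bool
distinctEdges []      = true
distinctEdges (q ∷ Q) = not (q ∈ᴱ Q) ∧ distinctEdges Q

countᵇ-absent : {A : Set} {p s : A → Bool} → (∀ x → p x ≡ true → s x ≡ true) →
  ∀ xs → any s xs ≡ false → countᵇ p xs ≡ 0
countᵇ-absent p⇒s [] _ = refl
countᵇ-absent {p = p} {s} p⇒s (x ∷ xs) none with ∨-≡false {s x} none | p x in px
... | _ , none′ | false = countᵇ-absent p⇒s xs none′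
... | sx≡false , _ | true with () ← trans (sym (p⇒s x px)) sx≡false

countᵇ-≤1 : ∀ {p : Edge → Bool} → (∀ x y → p x ≡ true → p y ≡ true → sameEdge x y ≡ true) →
  ∀ Q → distinctEdges Q ≡ true → countᵇ p Q ≤ 1
countᵇ-≤1 p-same [] _ = z≤n
countᵇ-≤1 {p} p-same (q ∷ Q) h with ∧-≡true {not (q ∈ᴱ Q)} h | p q in pq
... | _ , distinctQ | false = countᵇ-≤1 p-same Q distinctQ
... | q∉Q , _       | true  =
  s≤s (≤-reflexive (countᵇ-absent (λ y py → p-same q y pq py) Q (notTrue q∉Q)))
  where notTrue : ∀ {b} → not b ≡ true → b ≡ false
        notTrue {false} _ = refl

commonEdges : List Edge → List Edge → ℕ
commonEdges Q W = countᵇ (_∈ᴱ W) Q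

commonEdges-cong : ∀ Q W W' → W ≐ W' → commonEdges Q W ≡ commonEdges Q W'
commonEdges-cong Q W W' W≐W' = countᵇ-cong W≐W' Q

commonEdges-flipAt : ∀ vs Q W ε → distinctEdges Q ≡ true →
  commonEdges Q W ≤ suc (commonEdges Q (flipAt vs W ε))
commonEdges-flipAt vs Q W ε distinctQ =
  ≤-trans (countᵇ-subadditive (flipAt-keeps vs W ε) Q)
    (≤-trans (+-monoʳ-≤ (commonEdges Q (flipAt vs W ε)) (countᵇ-≤1 sameAsε Q distinctQ))
      (≤-reflexive (+-comm _ 1)))
  where
  sameAsε : ∀ x y → sameEdge x ε ≡ true → sameEdge y ε ≡ true → sameEdge x y ≡ true
  sameAsε x y xε yε = trans (sameEdge-congʳ y ε yε x) xε

-- For Q the edges outside V, the test 1 ≤ commonEdges Q W is the test W ≠ V.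
certifies : ℕ → List Edge → ℕ → List Edge → Bool
certifies n Q zero    W = true
certifies n Q (suc c) W =
  (suc c ≤ᵇ commonEdges Q W) ∨
  ((1 ≤ᵇ commonEdges Q W) ∧ all (λ l → isSide n l ∨ certifies n Q c (flipAt (upTo n) W l)) W)

module _ (n : ℕ) (Q V : List Edge)
         (distinctQ : distinctEdges Q ≡ true) (QV≡0 : commonEdges Q V ≡ 0) where

  FlipPath⇒commonEdges≤ : ∀ k W → FlipPath n k W V → commonEdges Q W ≤ k
  FlipPath⇒commonEdges≤ zero W W≈V =
    ≤-reflexive (trans (commonEdges-cong Q W V (≈ᴱ⇒≐ {W} {V} W≈V)) QV≡0)
  FlipPath⇒commonEdges≤ (suc k) W (W₁ , (ε , _ , _ , W₁≈) , path) =
    ≤-trans (commonEdges-flipAt (upTo n) Q W ε distinctQ)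
      (s≤s (≤-trans (≤-reflexive (sym (commonEdges-cong Q W₁ F (≈ᴱ⇒≐ {W₁} {F} W₁≈))))
                    (FlipPath⇒commonEdges≤ k W₁ path)))
    where F = flipAt (upTo n) W ε

  ≐-FlipPath⇒commonEdges≤ : ∀ k L W → W ≐ L → FlipPath n k W V → commonEdges Q L ≤ k
  ≐-FlipPath⇒commonEdges≤ k L W W≐L path =
    ≤-trans (≤-reflexive (sym (commonEdges-cong Q W L W≐L))) (FlipPath⇒commonEdges≤ k W path)

  certifies-sound : ∀ c k L W → certifies n Q c L ≡ true → W ≐ L → FlipPath n k W V → c ≤ k
  certifies-sound zero k _ _ _ _ _ = z≤n
  certifies-sound (suc c) k L W cert W≐L path with ∨-≡true {suc c ≤ᵇ commonEdges Q L} cert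
  ... | inj₁ enough = ≤-trans (≤ᵇ-≡true⇒≤ enough) (≐-FlipPath⇒commonEdges≤ k L W W≐L path)
  ... | inj₂ search with ∧-≡true {1 ≤ᵇ commonEdges Q L} search | k | path
  ...   | nonEmpty , _ | zero | W≈V =
    ⊥-elim (1+n≰n (≤-trans (≤ᵇ-≡true⇒≤ nonEmpty) (≐-FlipPath⇒commonEdges≤ 0 L W W≐L W≈V)))
  ...   | _ , flipsOk | suc k' | W₁ , (ε , ε∈W , interior , W₁≈) , path'
    with all-∈ᴱ _ ε L flipsOk (trans (sym (W≐L ε)) ε∈W)
  ...     | l , εl , ok with ∨-≡true {isSide n l} ok
  ...       | inj₁ side with () ← trans (sym interior) (trans (isSide-cong n ε l εl) side)
  ...       | inj₂ next = s≤s (certifies-sound c k' (flipAt (upTo n) L l) W₁ next W₁≐ path')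
    where
    W₁≐ : W₁ ≐ flipAt (upTo n) L l
    W₁≐ e = trans (≈ᴱ⇒≐ {W₁} {flipAt (upTo n) W ε} W₁≈ e)
                  (flipAt-cong (upTo n) {W} {L} {ε} {l} W≐L εl e)

  certifies⇒δ≥ : ∀ m U → certifies n Q m U ≡ true → δ≥ n (U , V) m
  certifies⇒δ≥ m U cert k = certifies-sound m k U U cert (λ _ → refl)

allEdges : ℕ → List Edge
allEdges n = concatMap (λ i → map (λ d → (i , suc (i + d))) (upTo (n ∸ suc i))) (upTo n)

edgesOutside : ℕ → List Edge → List Edge
edgesOutside n V = filter (λ e → T? (not (e ∈ᴱ V))) (allEdges n)

edgesOutside-disjoint : ∀ n V → commonEdges (edgesOutside n V) V ≡ 0
edgesOutside-disjoint n V = countᵇ-filter-not (_∈ᴱ V) (allEdges n)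

δ≥-by-search : ∀ n m P → distinctEdges (edgesOutside n (proj₂ P)) ≡ true →
  certifies n (edgesOutside n (proj₂ P)) m (proj₁ P) ≡ true → δ≥ n P m
δ≥-by-search n m (U , V) distinctQ =
  certifies⇒δ≥ n (edgesOutside n V) V distinctQ (edgesOutside-disjoint n V) m U

LowerBounds : ℕ → Set
LowerBounds n = δ≥ n (B n) (2 * n ∸ 11) × δ≥ n (C n) (2 * n ∸ 11)

lowerBounds-8 : LowerBounds 8
lowerBounds-8 = δ≥-by-search 8 _ (B 8) refl refl , δ≥-by-search 8 _ (C 8) refl refl

lowerBounds-9 : LowerBounds 9
lowerBounds-9 = δ≥-by-search 9 _ (B 9) refl refl , δ≥-by-search 9 _ (C 9) refl refl

lowerBounds-10 : LowerBounds 10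
lowerBounds-10 = δ≥-by-search 10 _ (B 10) refl refl , δ≥-by-search 10 _ (C 10) refl refl

lowerBounds-11 : LowerBounds 11
lowerBounds-11 = δ≥-by-search 11 _ (B 11) refl refl , δ≥-by-search 11 _ (C 11) refl refl

8≤n≤11⇒cases : ∀ {n} → 8 ≤ n → n ≤ 11 → n ≡ 8 ⊎ n ≡ 9 ⊎ n ≡ 10 ⊎ n ≡ 11
8≤n≤11⇒cases 8≤n n≤11 with m≤n⇒∃[o]m+o≡n 8≤n
... | 0 , refl = inj₁ refl
... | 1 , refl = inj₂ (inj₁ refl)
... | 2 , refl = inj₂ (inj₂ (inj₁ refl))
... | 3 , refl = inj₂ (inj₂ (inj₂ refl))
... | suc (suc (suc (suc o))) , refl = ⊥-elim (1+n≰n (≤-trans (m≤m+n 12 o) n≤11))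

proposition7 : (n : ℕ) → 8 ≤ n → n ≤ 11 →
    δ≥ n (B n) (2 * n ∸ 11) × δ≥ n (C n) (2 * n ∸ 11)
-- The cases are transported by subst rather than by matching n in the goal,
-- which would make the checker unfold the construction of B n for symbolic n.
proposition7 n 8≤n n≤11 =
  [ at lowerBounds-8 , [ at lowerBounds-9 , [ at lowerBounds-10 , at lowerBounds-11 ] ] ]
    (8≤n≤11⇒cases 8≤n n≤11)
  where
  at : ∀ {k} → LowerBounds k → n ≡ k → LowerBounds n
  at bounds n≡k = subst LowerBounds (sym n≡k) bounds
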